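{- Let $n\ge 2$ and $r\ge 1$ be integers such that $r<4n$ and $\frac{r(r-1)}{2}\equiv n+1 \pmod{2n}$, and let \[f(t)=f_{n,r}(t)=8n^2t^2+2n(2r-1)t+\left(\frac{r(r-1)}{2}-n\right)\in\mathbb{Z}[t].\] Then: (a) $f$ has a positive leading coefficient; (c) $f$ is not identically zero modulo any prime $p$, i.e. for every prime $p$ there is an integer $t$ with $p\nmid f(t)$; and (b) $f$ is irreducible in $\mathbb{Z}[t]$ if and only if $n$ is not a triangular number, i.e. $n\neq a(a+1)/2$ for every $a\in\mathbb{N}$. -}

module Defs where

open import Data.Nat as ℕ using (ℕ; zero; suc)
open import Data.Integer as ℤ using (ℤ; +_; _+_; _*_; _-_; 0ℤ; 1ℤ)
open import Data.Integer.Divisibility using (_∣_)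
open import Data.List using (List; []; _∷_; map)
open import Data.Product using (∃-syntax; _×_)
open import Data.Sum using (_⊎_)
open import Relation.Nullary using (¬_)
open import Relation.Binary.PropositionalEquality using (_≡_)

-- Polynomials in ℤ[t] as coefficient lists, lowest degree first.
Poly : Set
Poly = List ℤ

coeff : Poly → ℕ → ℤ
coeff []      _       = 0ℤ
coeff (a ∷ p) zero    = a
coeff (a ∷ p) (suc k) = coeff p k

-- equality of polynomials: all coefficients agree (ignores trailing zeros)
_≈ₚ_ : Poly → Poly → Set
p ≈ₚ q = ∀ k → coeff p k ≡ coeff q k

_+ₚ_ : Poly → Poly → Poly
[]      +ₚ q       = q
(a ∷ p) +ₚ []      = a ∷ p
(a ∷ p) +ₚ (b ∷ q) = (a + b) ∷ (p +ₚ q)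

_*ₚ_ : Poly → Poly → Poly
[]      *ₚ q = []
(a ∷ p) *ₚ q = map (a *_) q +ₚ (0ℤ ∷ (p *ₚ q))

eval : Poly → ℤ → ℤ
eval []      t = 0ℤ
eval (a ∷ p) t = a + t * eval p t

-- leading coefficient: last nonzero coefficient (0 for the zero polynomial)
private
  pickLead : ℤ → ℤ → ℤ
  pickLead a (+ zero) = a
  pickLead a l        = l

lead : Poly → ℤ
lead []      = 0ℤ
lead (a ∷ p) = pickLead a (lead p)

IsUnit : Poly → Set
IsUnit p = ∃[ q ] ((p *ₚ q) ≈ₚ (1ℤ ∷ []))

Irreducible : Poly → Set
Irreducible p = ¬ (p ≈ₚ []) × ¬ IsUnit p
              × (∀ g h → p ≈ₚ (g *ₚ h) → IsUnit g ⊎ IsUnit h)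

tri : ℕ → ℕ
tri r = (r ℕ.* (r ℕ.∸ 1)) ℕ./ 2

CongMod : ℕ → ℕ → ℕ → Set
CongMod a b m = (+ m) ∣ ((+ a) - (+ b))

fpoly : ℕ → ℕ → Poly
fpoly n r = ((+ tri r) - (+ n))
          ∷ ((+ (2 ℕ.* n)) * ((+ (2 ℕ.* r)) - 1ℤ))
          ∷ (+ (8 ℕ.* n ℕ.* n))
          ∷ []

-- Write T = r(r − 1)/2. The congruence hypothesis says f(0) = T − n = 1 + 2nK, which is coprime to
-- 16n² = f(1) + f(−1) − 2f(0); so f is primitive and no prime divides f(0), f(1) and f(−1) at once.
-- A proper factorisation of a primitive quadratic must be into two linear factors, which forces its
-- discriminant 4n²(8n + 1) to be a square, i.e. 8n + 1 = (2a + 1)², i.e. n = a(a + 1)/2. Conversely,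
-- for such n we have 2(T − n) = (r + a)(r − a − 1), and halving the even one of these two factors gives
-- f = (x + 2nt)(y + 4nt).

module Submission where

open import Defs

module Polynomials where

  open import Data.Integer using (ℤ; +_; _+_; _-_; _*_; -_; 0ℤ; 1ℤ)
  import Data.Integer.Properties as ℤ
  open import Data.Integer.Divisibility using () renaming (_∣_ to _∣ᵤ_)
  open import Data.Integer.Divisibility.Signed using (_∣_; divides; _∣?_; ∣ᵤ⇒∣; ∣⇒∣ᵤ)
  open import Data.Integer.Tactic.RingSolver using (solve-∀)
  open import Data.Nat as ℕ using (ℕ; zero; suc; z≤n; s≤s; z<s)
  import Data.Nat.Properties as ℕₚ
  open import Data.Nat.Divisibility using (∣1⇒≡1)
  open import Data.Nat.Primality using (Prime; ¬prime[1])
  open import Data.List using ([]; _∷_; map)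
  open import Data.Product using (∃-syntax; ∃₂; _×_; _,_; proj₁)
  open import Data.Sum using (_⊎_; inj₁; inj₂; [_,_]′)
  open import Data.Empty using (⊥-elim)
  open import Function using (_∘_)
  open import Relation.Nullary using (¬_; yes; no; contradiction)
  open import Relation.Binary.Definitions using (tri<; tri≈; tri>)
  open import Relation.Binary.PropositionalEquality
  open ≡-Reasoning

  *-≢0 : ∀ {i j} → i ≢ 0ℤ → j ≢ 0ℤ → i * j ≢ 0ℤ
  *-≢0 {i} i≢0 j≢0 ij≡0 = [ i≢0 , j≢0 ]′ (ℤ.i*j≡0⇒i≡0∨j≡0 i ij≡0)

  coeff-+ₚ : ∀ p q k → coeff (p +ₚ q) k ≡ coeff p k + coeff q k
  coeff-+ₚ []      q       k       = sym (ℤ.+-identityˡ _)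
  coeff-+ₚ (a ∷ p) []      k       = sym (ℤ.+-identityʳ _)
  coeff-+ₚ (a ∷ p) (b ∷ q) zero    = refl
  coeff-+ₚ (a ∷ p) (b ∷ q) (suc k) = coeff-+ₚ p q k

  coeff-map-* : ∀ a q k → coeff (map (a *_) q) k ≡ a * coeff q k
  coeff-map-* a []      k       = sym (ℤ.*-zeroʳ a)
  coeff-map-* a (b ∷ q) zero    = refl
  coeff-map-* a (b ∷ q) (suc k) = coeff-map-* a q k

  coeff-∷-*ₚ : ∀ a p q k → coeff ((a ∷ p) *ₚ q) k ≡ a * coeff q k + coeff (0ℤ ∷ (p *ₚ q)) k
  coeff-∷-*ₚ a p q k = trans (coeff-+ₚ (map (a *_) q) (0ℤ ∷ (p *ₚ q)) k) (cong (_+ _) (coeff-map-* a q k))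

  coeff-*ₚ-zero : ∀ g h → coeff (g *ₚ h) 0 ≡ coeff g 0 * coeff h 0
  coeff-*ₚ-zero []      h = refl
  coeff-*ₚ-zero (a ∷ p) h = trans (coeff-∷-*ₚ a p h 0) (ℤ.+-identityʳ _)

  0∷-≈[] : ∀ {p} → p ≈ₚ [] → (0ℤ ∷ p) ≈ₚ []
  0∷-≈[] p≈0 zero    = refl
  0∷-≈[] p≈0 (suc k) = p≈0 k

  *ₚ-zeroˡ : ∀ p q → p ≈ₚ [] → (p *ₚ q) ≈ₚ []
  *ₚ-zeroˡ []      q _     _ = refl
  *ₚ-zeroˡ (a ∷ p) q ap≈0 k = begin
    coeff ((a ∷ p) *ₚ q) k                   ≡⟨ coeff-∷-*ₚ a p q k ⟩
    a * coeff q k + coeff (0ℤ ∷ (p *ₚ q)) k  ≡⟨ cong₂ _+_ (cong (_* coeff q k) (ap≈0 0))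
                                                         (0∷-≈[] (*ₚ-zeroˡ p q (ap≈0 ∘ suc)) k) ⟩
    0ℤ                                       ∎

  *ₚ-zeroʳ : ∀ p q → q ≈ₚ [] → (p *ₚ q) ≈ₚ []
  *ₚ-zeroʳ []      q _    _ = refl
  *ₚ-zeroʳ (a ∷ p) q q≈0 k = begin
    coeff ((a ∷ p) *ₚ q) k                   ≡⟨ coeff-∷-*ₚ a p q k ⟩
    a * coeff q k + coeff (0ℤ ∷ (p *ₚ q)) k  ≡⟨ cong₂ _+_ (trans (cong (a *_) (q≈0 k)) (ℤ.*-zeroʳ a))
                                                         (0∷-≈[] (*ₚ-zeroʳ p q q≈0) k) ⟩
    0ℤ                                       ∎

  DegreeAtMost : Poly → ℕ → Set
  DegreeAtMost p d = ∀ k → d ℕ.< k → coeff p k ≡ 0ℤ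

  HasDegree : Poly → ℕ → Set
  HasDegree p d = coeff p d ≢ 0ℤ × DegreeAtMost p d

  ≈[]⊎hasDegree : ∀ p → p ≈ₚ [] ⊎ ∃[ d ] HasDegree p d
  ≈[]⊎hasDegree []      = inj₁ λ _ → refl
  ≈[]⊎hasDegree (a ∷ p) with ≈[]⊎hasDegree p
  ... | inj₂ (d , p[d]≢0 , p≤d) = inj₂ (suc d , p[d]≢0 , λ { zero () ; (suc k) (s≤s d<k) → p≤d k d<k })
  ... | inj₁ p≈0 with a ℤ.≟ 0ℤ
  ...   | yes a≡0 = inj₁ λ { zero → a≡0 ; (suc k) → p≈0 k }
  ...   | no  a≢0 = inj₂ (0 , a≢0 , λ { zero () ; (suc k) _ → p≈0 k })

  hasDegree-unique : ∀ p {d e} → HasDegree p d → HasDegree p e → d ≡ e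
  hasDegree-unique p {d} {e} (p[d]≢0 , p≤d) (p[e]≢0 , p≤e) with ℕₚ.<-cmp d e
  ... | tri< d<e _ _ = contradiction (p≤d e d<e) p[e]≢0
  ... | tri≈ _ d≡e _ = d≡e
  ... | tri> _ _ e<d = contradiction (p≤e d e<d) p[d]≢0

  coeff-*ₚ-constˡ : ∀ g h → DegreeAtMost g 0 → ∀ k → coeff (g *ₚ h) k ≡ coeff g 0 * coeff h k
  coeff-*ₚ-constˡ []      h _    k = refl
  coeff-*ₚ-constˡ (a ∷ p) h g≤0 k = begin
    coeff ((a ∷ p) *ₚ h) k                   ≡⟨ coeff-∷-*ₚ a p h k ⟩
    a * coeff h k + coeff (0ℤ ∷ (p *ₚ h)) k  ≡⟨ cong (λ t → a * coeff h k + t) (0∷-≈[] (*ₚ-zeroˡ p h p≈0) k) ⟩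
    a * coeff h k + 0ℤ                       ≡⟨ ℤ.+-identityʳ _ ⟩
    a * coeff h k                            ∎
    where
    p≈0 : p ≈ₚ []
    p≈0 k = g≤0 (suc k) z<s

  coeff-*ₚ-constʳ : ∀ g h → DegreeAtMost h 0 → ∀ k → coeff (g *ₚ h) k ≡ coeff g k * coeff h 0
  coeff-*ₚ-constʳ []      h _   k       = refl
  coeff-*ₚ-constʳ (a ∷ p) h h≤0 zero    = coeff-*ₚ-zero (a ∷ p) h
  coeff-*ₚ-constʳ (a ∷ p) h h≤0 (suc k) = begin
    coeff ((a ∷ p) *ₚ h) (suc k)             ≡⟨ coeff-∷-*ₚ a p h (suc k) ⟩
    a * coeff h (suc k) + coeff (p *ₚ h) k   ≡⟨ cong₂ _+_ (trans (cong (a *_) (h≤0 (suc k) z<s)) (ℤ.*-zeroʳ a))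
                                                         (coeff-*ₚ-constʳ p h h≤0 k) ⟩
    0ℤ + coeff p k * coeff h 0               ≡⟨ ℤ.+-identityˡ _ ⟩
    coeff p k * coeff h 0                    ∎

  *ₚ-degreeAtMost : ∀ g h {i m} → DegreeAtMost g i → DegreeAtMost h m → DegreeAtMost (g *ₚ h) (i ℕ.+ m)
  *ₚ-degreeAtMost []      h         g≤i h≤m k       _ = refl
  *ₚ-degreeAtMost (a ∷ p) h {zero}  g≤0 h≤m k       m<k = begin
    coeff ((a ∷ p) *ₚ h) k  ≡⟨ coeff-*ₚ-constˡ (a ∷ p) h g≤0 k ⟩
    a * coeff h k           ≡⟨ cong (a *_) (h≤m k m<k) ⟩
    a * 0ℤ                  ≡⟨ ℤ.*-zeroʳ a ⟩
    0ℤ                      ∎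
  *ₚ-degreeAtMost (a ∷ p) h {suc i} {m} g≤i h≤m (suc k) (s≤s i+m<k) = begin
    coeff ((a ∷ p) *ₚ h) (suc k)            ≡⟨ coeff-∷-*ₚ a p h (suc k) ⟩
    a * coeff h (suc k) + coeff (p *ₚ h) k  ≡⟨ cong₂ _+_ (cong (a *_) (h≤m (suc k) m<1+k))
                                                (*ₚ-degreeAtMost p h (λ j i<j → g≤i (suc j) (s≤s i<j)) h≤m k i+m<k) ⟩
    a * 0ℤ + 0ℤ                             ≡⟨ cong (_+ 0ℤ) (ℤ.*-zeroʳ a) ⟩
    0ℤ                                      ∎
    where
    m<1+k : m ℕ.< suc k
    m<1+k = s≤s (ℕₚ.≤-trans (ℕₚ.m≤n+m m i) (ℕₚ.<⇒≤ i+m<k))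

  coeff-*ₚ-top : ∀ g h {i m} → DegreeAtMost g i → DegreeAtMost h m →
                 coeff (g *ₚ h) (i ℕ.+ m) ≡ coeff g i * coeff h m
  coeff-*ₚ-top []      h         g≤i h≤m = refl
  coeff-*ₚ-top (a ∷ p) h {zero}  g≤0 h≤m = coeff-*ₚ-constˡ (a ∷ p) h g≤0 _
  coeff-*ₚ-top (a ∷ p) h {suc i} {m} g≤i h≤m = begin
    coeff ((a ∷ p) *ₚ h) (suc (i ℕ.+ m))            ≡⟨ coeff-∷-*ₚ a p h (suc (i ℕ.+ m)) ⟩
    a * coeff h (suc (i ℕ.+ m)) + coeff (p *ₚ h) (i ℕ.+ m)
      ≡⟨ cong₂ _+_ (cong (a *_) (h≤m _ (s≤s (ℕₚ.m≤n+m m i))))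
                   (coeff-*ₚ-top p h (λ j i<j → g≤i (suc j) (s≤s i<j)) h≤m) ⟩
    a * 0ℤ + coeff p i * coeff h m                  ≡⟨ cong (_+ _) (ℤ.*-zeroʳ a) ⟩
    0ℤ + coeff p i * coeff h m                      ≡⟨ ℤ.+-identityˡ _ ⟩
    coeff p i * coeff h m                           ∎

  hasDegree-*ₚ : ∀ g h {i m} → HasDegree g i → HasDegree h m → HasDegree (g *ₚ h) (i ℕ.+ m)
  hasDegree-*ₚ g h (g[i]≢0 , g≤i) (h[m]≢0 , h≤m) =
      (λ gh≡0 → *-≢0 g[i]≢0 h[m]≢0 (trans (sym (coeff-*ₚ-top g h g≤i h≤m)) gh≡0))
    , *ₚ-degreeAtMost g h g≤i h≤m

  factor-degrees : ∀ f g h {d} → HasDegree f d → f ≈ₚ (g *ₚ h) →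
                   ∃₂ λ i m → HasDegree g i × HasDegree h m × i ℕ.+ m ≡ d
  factor-degrees f g h {d} f°d@(f[d]≢0 , _) f≈gh with ≈[]⊎hasDegree g | ≈[]⊎hasDegree h
  ... | inj₁ g≈0 | _        = contradiction (trans (f≈gh d) (*ₚ-zeroˡ g h g≈0 d)) f[d]≢0
  ... | inj₂ _   | inj₁ h≈0 = contradiction (trans (f≈gh d) (*ₚ-zeroʳ g h h≈0 d)) f[d]≢0
  ... | inj₂ (i , g°i) | inj₂ (m , h°m) = i , m , g°i , h°m , hasDegree-unique f f°[i+m] f°d
    where
    f°[i+m] : HasDegree f (i ℕ.+ m)
    f°[i+m] with hasDegree-*ₚ g h g°i h°m
    ... | gh[i+m]≢0 , gh≤i+m = (λ f[i+m]≡0 → gh[i+m]≢0 (trans (sym (f≈gh _)) f[i+m]≡0))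
                             , λ k lt → trans (f≈gh k) (gh≤i+m k lt)

  [1]-hasDegree0 : HasDegree (1ℤ ∷ []) 0
  [1]-hasDegree0 = (λ ()) , λ { zero () ; (suc k) _ → refl }

  unit⇒hasDegree0 : ∀ g → IsUnit g → HasDegree g 0
  unit⇒hasDegree0 g (q , gq≈1) with factor-degrees (1ℤ ∷ []) g q [1]-hasDegree0 (sym ∘ gq≈1)
  ... | i , _ , g°i , _ , i+m≡0 = subst (HasDegree g) (ℕₚ.m+n≡0⇒m≡0 i i+m≡0) g°i

  hasDegree-suc⇒¬unit : ∀ g {d} → HasDegree g (suc d) → ¬ IsUnit g
  hasDegree-suc⇒¬unit g g°1+d u = ℕₚ.0≢1+n (hasDegree-unique g (unit⇒hasDegree0 g u) g°1+d)

  linear-hasDegree : ∀ {b c} → c ≢ 0ℤ → HasDegree (b ∷ c ∷ []) 1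
  linear-hasDegree c≢0 = c≢0 , λ { zero () ; (suc zero) (s≤s ()) ; (suc (suc k)) _ → refl }

  nonconstant-product-¬irreducible : ∀ f g h {i m} → f ≈ₚ (g *ₚ h) →
                                     HasDegree g (suc i) → HasDegree h (suc m) → ¬ Irreducible f
  nonconstant-product-¬irreducible f g h f≈gh g° h° (_ , _ , split) =
    [ hasDegree-suc⇒¬unit g g° , hasDegree-suc⇒¬unit h h° ]′ (split g h f≈gh)

  constant-unit : ∀ g → DegreeAtMost g 0 → coeff g 0 ∣ 1ℤ → IsUnit g
  constant-unit g g≤0 (divides q 1≡q*g₀) = q ∷ [] , λ k → trans (coeff-*ₚ-constʳ g (q ∷ []) [q]≤0 k) (g*q k)
    where
    [q]≤0 : DegreeAtMost (q ∷ []) 0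
    [q]≤0 (suc k) _ = refl
    g*q : ∀ k → coeff g k * q ≡ coeff (1ℤ ∷ []) k
    g*q zero    = trans (ℤ.*-comm _ q) (sym 1≡q*g₀)
    g*q (suc k) = cong (_* q) (g≤0 (suc k) z<s)

  Primitive : Poly → Set
  Primitive f = ∀ {c} → (∀ k → c ∣ coeff f k) → c ∣ 1ℤ

  primitive-constant-factorˡ : ∀ f g h → Primitive f → f ≈ₚ (g *ₚ h) → DegreeAtMost g 0 → IsUnit g
  primitive-constant-factorˡ f g h f-primitive f≈gh g≤0 = constant-unit g g≤0 (f-primitive λ k →
    divides (coeff h k) (trans (f≈gh k) (trans (coeff-*ₚ-constˡ g h g≤0 k) (ℤ.*-comm (coeff g 0) (coeff h k)))))

  primitive-constant-factorʳ : ∀ f g h → Primitive f → f ≈ₚ (g *ₚ h) → DegreeAtMost h 0 → IsUnit h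
  primitive-constant-factorʳ f g h f-primitive f≈gh h≤0 = constant-unit h h≤0 (f-primitive λ k →
    divides (coeff g k) (trans (f≈gh k) (coeff-*ₚ-constʳ g h h≤0 k)))

  coeff-*ₚ-linearˡ : ∀ g h → DegreeAtMost g 1 → ∀ k →
                     coeff (g *ₚ h) (suc k) ≡ coeff g 0 * coeff h (suc k) + coeff g 1 * coeff h k
  coeff-*ₚ-linearˡ []      h _   k = refl
  coeff-*ₚ-linearˡ (a ∷ p) h g≤1 k = trans (coeff-∷-*ₚ a p h (suc k))
    (cong (λ t → a * coeff h (suc k) + t) (coeff-*ₚ-constˡ p h (λ j 0<j → g≤1 (suc j) (s≤s 0<j)) k))

  discriminant : Poly → ℤ
  discriminant f = coeff f 1 * coeff f 1 - + 4 * coeff f 0 * coeff f 2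

  linear-product-discriminant : ∀ f g h → f ≈ₚ (g *ₚ h) → DegreeAtMost g 1 → DegreeAtMost h 1 →
                                ∃[ x ] x * x ≡ discriminant f
  linear-product-discriminant f g h f≈gh g≤1 h≤1 = g₀ * h₁ - g₁ * h₀ , proof
    where
    g₀ g₁ h₀ h₁ : ℤ
    g₀ = coeff g 0
    g₁ = coeff g 1
    h₀ = coeff h 0
    h₁ = coeff h 1
    f₀ : coeff f 0 ≡ g₀ * h₀
    f₀ = trans (f≈gh 0) (coeff-*ₚ-zero g h)
    f₁ : coeff f 1 ≡ g₀ * h₁ + g₁ * h₀
    f₁ = trans (f≈gh 1) (coeff-*ₚ-linearˡ g h g≤1 0)
    f₂ : coeff f 2 ≡ g₁ * h₁
    f₂ = begin
      coeff f 2                     ≡⟨ trans (f≈gh 2) (coeff-*ₚ-linearˡ g h g≤1 1) ⟩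
      g₀ * coeff h 2 + g₁ * h₁      ≡⟨ cong (λ h₂ → g₀ * h₂ + g₁ * h₁) (h≤1 2 (s≤s (s≤s z≤n))) ⟩
      g₀ * 0ℤ + g₁ * h₁             ≡⟨ cong (_+ g₁ * h₁) (ℤ.*-zeroʳ g₀) ⟩
      0ℤ + g₁ * h₁                  ≡⟨ ℤ.+-identityˡ _ ⟩
      g₁ * h₁                       ∎
    identity : ∀ a b c d → (a * d - b * c) * (a * d - b * c) ≡ (a * d + b * c) * (a * d + b * c) - + 4 * (a * c) * (b * d)
    identity = solve-∀
    proof : (g₀ * h₁ - g₁ * h₀) * (g₀ * h₁ - g₁ * h₀) ≡ discriminant f
    proof rewrite f₀ | f₁ | f₂ = identity g₀ g₁ h₀ h₁

  primitive-quadratic-irreducible : ∀ f → HasDegree f 2 → Primitive f → (∀ x → x * x ≢ discriminant f) →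
                                    Irreducible f
  primitive-quadratic-irreducible f f°2 f-primitive nonsquare = f≉0 , hasDegree-suc⇒¬unit f f°2 , split
    where
    f≉0 : ¬ f ≈ₚ []
    f≉0 f≈0 = proj₁ f°2 (f≈0 2)
    split : ∀ g h → f ≈ₚ (g *ₚ h) → IsUnit g ⊎ IsUnit h
    split g h f≈gh with factor-degrees f g h f°2 f≈gh
    ... | 0 , _ , (_ , g≤0) , _ , refl = inj₁ (primitive-constant-factorˡ f g h f-primitive f≈gh g≤0)
    ... | 1 , _ , (_ , g≤1) , (_ , h≤1) , refl with linear-product-discriminant f g h f≈gh g≤1 h≤1
    ...   | x , x²≡Δ = ⊥-elim (nonsquare x x²≡Δ)
    split g h f≈gh | 2 , _ , _ , (_ , h≤0) , refl = inj₂ (primitive-constant-factorʳ f g h f-primitive f≈gh h≤0)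
    split g h f≈gh | suc (suc (suc _)) , _ , _ , _ , ()

  no-fixed-prime-divisor : ∀ f → (∀ {d} → d ∣ eval f 0ℤ → d ∣ eval f 1ℤ → d ∣ eval f (- 1ℤ) → d ∣ 1ℤ) →
                           ∀ p → Prime p → ∃[ t ] ¬ (+ p ∣ᵤ eval f t)
  no-fixed-prime-divisor f values-coprime p p-prime
    with + p ∣? eval f 0ℤ | + p ∣? eval f 1ℤ | + p ∣? eval f (- 1ℤ)
  ... | no p∤f[0] | _         | _          = 0ℤ     , p∤f[0] ∘ ∣ᵤ⇒∣
  ... | yes _     | no p∤f[1] | _          = 1ℤ     , p∤f[1] ∘ ∣ᵤ⇒∣
  ... | yes _     | yes _     | no p∤f[-1] = - 1ℤ , p∤f[-1] ∘ ∣ᵤ⇒∣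
  ... | yes p∣f[0] | yes p∣f[1] | yes p∣f[-1] =
    ⊥-elim (¬prime[1] (subst Prime (∣1⇒≡1 (∣⇒∣ᵤ (values-coprime p∣f[0] p∣f[1] p∣f[-1]))) p-prime))

module NaturalNumbers where

  open import Data.Nat
  open import Data.Nat.Properties
  open import Data.Nat.DivMod using (_/_; m/n*n≡m; m*[n/m]≡n)
  open import Data.Nat.Divisibility using (_∣_; divides; ∣-refl)
  open import Data.Nat.GCD using (gcd; gcd[m,n]∣m; gcd[m,n]∣n; gcd[m,n]≢0)
  open import Data.Nat.Coprimality using (Coprime; coprime-/gcd; coprime-divisor)
  import Data.Nat.Coprimality as Coprime
  open import Data.Nat.Tactic.RingSolver using (solve-∀)
  open import Data.Product using (∃-syntax; _,_)
  open import Data.Sum using (_⊎_; inj₁; inj₂)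
  open import Relation.Nullary using (contradiction)
  open import Relation.Binary.PropositionalEquality
  open ≡-Reasoning

  even⊎odd : ∀ m → ∃[ q ] (m ≡ 2 * q ⊎ m ≡ suc (2 * q))
  even⊎odd zero    = 0 , inj₁ refl
  even⊎odd (suc m) with even⊎odd m
  ... | q , inj₁ m≡2q   = q , inj₂ (cong suc m≡2q)
  ... | q , inj₂ m≡1+2q = suc q , inj₁ (trans (cong suc m≡1+2q) (double-suc q))
    where
    double-suc : ∀ q → suc (suc (2 * q)) ≡ 2 * suc q
    double-suc = solve-∀

  2∣m*[m+1] : ∀ m → 2 ∣ m * (m + 1)
  2∣m*[m+1] m with even⊎odd m
  ... | q , inj₁ refl = divides (q * (2 * q + 1)) (even q)
    where
    even : ∀ q → 2 * q * (2 * q + 1) ≡ q * (2 * q + 1) * 2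
    even = solve-∀
  ... | q , inj₂ refl = divides ((2 * q + 1) * (q + 1)) (odd q)
    where
    odd : ∀ q → suc (2 * q) * (suc (2 * q) + 1) ≡ (2 * q + 1) * (q + 1) * 2
    odd = solve-∀

  2*[m*[m+1]/2]≡m*[m+1] : ∀ m → 2 * (m * (m + 1) / 2) ≡ m * (m + 1)
  2*[m*[m+1]/2]≡m*[m+1] m = m*[n/m]≡n (2∣m*[m+1] m)

  coprime-square-quotient : ∀ {x y k} → Coprime x y → x * x ≡ y * y * k → k ≡ x * x
  coprime-square-quotient {x} {y} {k} coprime x²≡y²k = begin
    k          ≡⟨ sym (*-identityˡ k) ⟩
    1 * 1 * k  ≡⟨ cong (λ z → z * z * k) (sym y≡1) ⟩
    y * y * k  ≡⟨ sym x²≡y²k ⟩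
    x * x      ∎
    where
    rearrange : ∀ y k → y * y * k ≡ y * k * y
    rearrange = solve-∀
    y∣x : y ∣ x
    y∣x = coprime-divisor (Coprime.sym coprime) (divides (y * k) (trans x²≡y²k (rearrange y k)))
    y≡1 : y ≡ 1
    y≡1 = coprime (y∣x , ∣-refl)

  square-quotient : ∀ x y k → y ≢ 0 → x * x ≡ y * y * k → ∃[ s ] k ≡ s * s
  square-quotient x y k y≢0 x²≡y²k = x / d , coprime-square-quotient (coprime-/gcd x y) reduced
    where
    d : ℕ
    d = gcd x y
    instance
      d≢0 : NonZero d
      d≢0 = ≢-nonZero (gcd[m,n]≢0 x y (inj₂ y≢0))
    squares : ∀ a b → a * a * (b * b) ≡ a * b * (a * b)
    squares = solve-∀
    cofactor : ∀ a b k → a * b * (a * b) * k ≡ a * a * k * (b * b)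
    cofactor = solve-∀
    reduced : x / d * (x / d) ≡ y / d * (y / d) * k
    reduced = *-cancelʳ-≡ _ _ (d * d) {{m*n≢0 d d}} (begin
      x / d * (x / d) * (d * d)      ≡⟨ squares (x / d) d ⟩
      x / d * d * (x / d * d)        ≡⟨ cong (λ z → z * z) (m/n*n≡m (gcd[m,n]∣m x y)) ⟩
      x * x                          ≡⟨ x²≡y²k ⟩
      y * y * k                      ≡⟨ cong (λ z → z * z * k) (sym (m/n*n≡m (gcd[m,n]∣n x y))) ⟩
      y / d * d * (y / d * d) * k    ≡⟨ cofactor (y / d) d k ⟩
      y / d * (y / d) * k * (d * d)  ∎)

  8n+1≡s²⇒2n≡a[a+1] : ∀ n s → 8 * n + 1 ≡ s * s → ∃[ a ] 2 * n ≡ a * (a + 1)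
  8n+1≡s²⇒2n≡a[a+1] n s 8n+1≡s² with even⊎odd s
  ... | a , inj₁ refl = contradiction (trans (even a) (trans (sym 8n+1≡s²) (odd n))) (even≢odd (2 * (a * a)) (4 * n))
    where
    even : ∀ a → 2 * (2 * (a * a)) ≡ 2 * a * (2 * a)
    even = solve-∀
    odd : ∀ n → 8 * n + 1 ≡ suc (2 * (4 * n))
    odd = solve-∀
  ... | a , inj₂ refl = a , *-cancelˡ-≡ _ _ 4 (+-cancelʳ-≡ 1 _ _ (trans (octuple n) (trans 8n+1≡s² (odd-square a))))
    where
    octuple : ∀ n → 4 * (2 * n) + 1 ≡ 8 * n + 1
    octuple = solve-∀
    odd-square : ∀ a → suc (2 * a) * suc (2 * a) ≡ 4 * (a * (a + 1)) + 1
    odd-square = solve-∀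

module Family where

  open import Data.Integer using (ℤ; +_; _+_; _-_; _*_; -_; 0ℤ; 1ℤ)
  import Data.Integer.Properties as ℤ
  open import Data.Integer.Divisibility.Signed using (_∣_; ∣m⇒∣m*n; ∣n⇒∣m*n; ∣m∣n⇒∣m-n; ∣m∣n⇒∣m+n)
  open import Data.Integer.Tactic.RingSolver using (solve-∀)
  import Data.Nat as ℕ
  open import Data.Nat using (zero; suc)
  open import Data.List using ([]; _∷_)
  open import Data.Product using (∃-syntax; _×_; _,_)
  open import Data.Sum using (inj₁; inj₂)
  open import Relation.Nullary using (¬_)
  open import Relation.Binary.PropositionalEquality
  open ≡-Reasoning
  open Polynomials
  open NaturalNumbers using (even⊎odd)

  ∣1+2NK∧∣16N²⇒∣1 : ∀ {d} N K → d ∣ 1ℤ + + 2 * N * K → d ∣ + 2 * (+ 8 * N * N) → d ∣ 1ℤ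
  ∣1+2NK∧∣16N²⇒∣1 {d} N K d∣u d∣16N² =
    subst (d ∣_) (bezout N K) (∣m∣n⇒∣m+n (∣m⇒∣m*n _ d∣u) (∣m⇒∣m*n (N * N * (K * K * (K * K))) d∣16N²))
    where
    -- (1 + x)(1 − x)(1 + x²) = 1 − x⁴ with x = 2NK, and x⁴ = 16N² · N²K⁴
    bezout : ∀ N K → (1ℤ + + 2 * N * K) * ((1ℤ - + 2 * N * K) * (1ℤ + + 2 * N * K * (+ 2 * N * K)))
                     + + 2 * (+ 8 * N * N) * (N * N * (K * K * (K * K))) ≡ 1ℤ
    bezout = solve-∀

  ∣values⇒∣2*coeff₂ : ∀ {d} a b c → let q = a ∷ b ∷ c ∷ [] in
                      d ∣ eval q 1ℤ → d ∣ eval q (- 1ℤ) → d ∣ eval q 0ℤ → d ∣ + 2 * c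
  ∣values⇒∣2*coeff₂ {d} a b c d∣q[1] d∣q[-1] d∣q[0] =
    subst (d ∣_) (second-difference a b c) (∣m∣n⇒∣m-n (∣m∣n⇒∣m+n d∣q[1] d∣q[-1]) (∣n⇒∣m*n (+ 2) d∣q[0]))
    where
    -- q(1) + q(−1) − 2q(0), with eval unfolded
    second-difference : ∀ a b c → (a + 1ℤ * (b + 1ℤ * (c + 1ℤ * 0ℤ))) + (a + - 1ℤ * (b + - 1ℤ * (c + - 1ℤ * 0ℤ)))
                                  - + 2 * (a + 0ℤ * (b + 0ℤ * (c + 0ℤ * 0ℤ))) ≡ + 2 * c
    second-difference = solve-∀

  -- r + a and r − a − 1 differ by the odd number 2a + 1, so one of them is even
  halve-even-factor : ∀ r a → ∃[ x ] ∃[ y ] (+ 2 * x + y ≡ + 2 * + r - 1ℤ × + 2 * (x * y) ≡ (+ r + + a) * (+ r - + a - 1ℤ))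
  halve-even-factor r a with even⊎odd (r ℕ.+ a)
  ... | q , inj₁ r+a≡2q = + q , + r - + a - 1ℤ , linear , product
    where
    R+A≡2Q : + r + + a ≡ + 2 * + q
    R+A≡2Q = trans (sym (ℤ.pos-+ r a)) (trans (cong +_ r+a≡2q) (ℤ.pos-* 2 q))
    linear : + 2 * + q + (+ r - + a - 1ℤ) ≡ + 2 * + r - 1ℤ
    linear = trans (cong (_+ (+ r - + a - 1ℤ)) (sym R+A≡2Q)) (lin (+ r) (+ a))
      where
      lin : ∀ R A → R + A + (R - A - 1ℤ) ≡ + 2 * R - 1ℤ
      lin = solve-∀
    product : + 2 * (+ q * (+ r - + a - 1ℤ)) ≡ (+ r + + a) * (+ r - + a - 1ℤ)
    product = trans (sym (ℤ.*-assoc (+ 2) (+ q) _)) (cong (_* (+ r - + a - 1ℤ)) (sym R+A≡2Q))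
  ... | q , inj₂ r+a≡1+2q = + q - + a , + r + + a , linear , product
    where
    R+A≡1+2Q : + r + + a ≡ 1ℤ + + 2 * + q
    R+A≡1+2Q = trans (sym (ℤ.pos-+ r a)) (trans (cong +_ r+a≡1+2q) (trans (ℤ.pos-+ 1 (2 ℕ.* q)) (cong (λ k → 1ℤ + k) (ℤ.pos-* 2 q))))
    linear : + 2 * (+ q - + a) + (+ r + + a) ≡ + 2 * + r - 1ℤ
    linear = trans (lin₁ (+ r) (+ a) (+ q)) (trans (cong (λ s → s + (+ r) - + a - 1ℤ) (sym R+A≡1+2Q)) (lin₂ (+ r) (+ a)))
      where
      lin₁ : ∀ R A Q → + 2 * (Q - A) + (R + A) ≡ 1ℤ + + 2 * Q + R - A - 1ℤ
      lin₁ = solve-∀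
      lin₂ : ∀ R A → R + A + R - A - 1ℤ ≡ + 2 * R - 1ℤ
      lin₂ = solve-∀
    product : + 2 * ((+ q - + a) * (+ r + + a)) ≡ (+ r + + a) * (+ r - + a - 1ℤ)
    product = trans (prod₁ (+ r) (+ a) (+ q)) (trans (cong (λ s → (s - + 2 * + a - 1ℤ) * (+ r + + a)) (sym R+A≡1+2Q)) (prod₂ (+ r) (+ a)))
      where
      prod₁ : ∀ R A Q → + 2 * ((Q - A) * (R + A)) ≡ (1ℤ + + 2 * Q - + 2 * A - 1ℤ) * (R + A)
      prod₁ = solve-∀
      prod₂ : ∀ R A → (R + A - + 2 * A - 1ℤ) * (R + A) ≡ (R + A) * (R - A - 1ℤ)
      prod₂ = solve-∀

  -- f_{n,r} with its coefficient r(r − 1)/2 abstracted to T, so that ring normalisation applies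
  module Fnr (N R T : ℤ) where

    f : Poly
    f = T - N ∷ + 2 * N * (+ 2 * R - 1ℤ) ∷ + 8 * N * N ∷ []

    f-hasDegree2 : N ≢ 0ℤ → HasDegree f 2
    f-hasDegree2 N≢0 = *-≢0 (*-≢0 {+ 8} (λ ()) N≢0) N≢0 , λ where
      zero                ()
      (suc zero)          (ℕ.s≤s ())
      (suc (suc zero))    (ℕ.s≤s (ℕ.s≤s ()))
      (suc (suc (suc k))) _ → refl

    f-primitive : ∀ K → T - N ≡ 1ℤ + + 2 * N * K → Primitive f
    f-primitive K T-N≡1+2NK c∣f =
      ∣1+2NK∧∣16N²⇒∣1 N K (subst (_ ∣_) T-N≡1+2NK (c∣f 0)) (∣n⇒∣m*n (+ 2) (c∣f 2))

    f-∣values⇒∣1 : ∀ K {d} → T - N ≡ 1ℤ + + 2 * N * K →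
                   d ∣ eval f 0ℤ → d ∣ eval f 1ℤ → d ∣ eval f (- 1ℤ) → d ∣ 1ℤ
    f-∣values⇒∣1 K T-N≡1+2NK d∣f[0] d∣f[1] d∣f[-1] = ∣1+2NK∧∣16N²⇒∣1 N K
      (subst (_ ∣_) (trans (ℤ.+-identityʳ _) T-N≡1+2NK) d∣f[0])
      (∣values⇒∣2*coeff₂ (T - N) (+ 2 * N * (+ 2 * R - 1ℤ)) (+ 8 * N * N) d∣f[1] d∣f[-1] d∣f[0])

    f-discriminant : + 2 * T ≡ R * (R - 1ℤ) → discriminant f ≡ + 2 * N * (+ 2 * N) * (+ 8 * N + 1ℤ)
    f-discriminant 2T≡R[R-1] = begin
      discriminant f                                                        ≡⟨ expand N R T ⟩
      + 2 * N * (+ 2 * N) * ((+ 2 * R - 1ℤ) * (+ 2 * R - 1ℤ) - + 4 * (+ 2 * T) + + 8 * N)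
        ≡⟨ cong (λ 2T → + 2 * N * (+ 2 * N) * ((+ 2 * R - 1ℤ) * (+ 2 * R - 1ℤ) - + 4 * 2T + + 8 * N)) 2T≡R[R-1] ⟩
      + 2 * N * (+ 2 * N) * ((+ 2 * R - 1ℤ) * (+ 2 * R - 1ℤ) - + 4 * (R * (R - 1ℤ)) + + 8 * N)
        ≡⟨ simplify N R ⟩
      + 2 * N * (+ 2 * N) * (+ 8 * N + 1ℤ)                                  ∎
      where
      expand : ∀ N R T → + 2 * N * (+ 2 * R - 1ℤ) * (+ 2 * N * (+ 2 * R - 1ℤ)) - + 4 * (T - N) * (+ 8 * N * N)
                         ≡ + 2 * N * (+ 2 * N) * ((+ 2 * R - 1ℤ) * (+ 2 * R - 1ℤ) - + 4 * (+ 2 * T) + + 8 * N)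
      expand = solve-∀
      simplify : ∀ N R → + 2 * N * (+ 2 * N) * ((+ 2 * R - 1ℤ) * (+ 2 * R - 1ℤ) - + 4 * (R * (R - 1ℤ)) + + 8 * N)
                         ≡ + 2 * N * (+ 2 * N) * (+ 8 * N + 1ℤ)
      simplify = solve-∀

    f-factorisation : ∀ x y → + 2 * x + y ≡ + 2 * R - 1ℤ → x * y ≡ T - N →
                      f ≈ₚ ((x ∷ + 2 * N ∷ []) *ₚ (y ∷ + 4 * N ∷ []))
    f-factorisation _ _ _         xy≡T-N zero                = sym (trans (ℤ.+-identityʳ _) xy≡T-N)
    f-factorisation x y 2x+y≡2R-1 _      (suc zero)          = begin
      + 2 * N * (+ 2 * R - 1ℤ)           ≡⟨ cong (+ 2 * N *_) (sym 2x+y≡2R-1) ⟩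
      + 2 * N * (+ 2 * x + y)            ≡⟨ middle N x y ⟩
      x * (+ 4 * N) + (+ 2 * N * y + 0ℤ) ∎
      where
      middle : ∀ N x y → + 2 * N * (+ 2 * x + y) ≡ x * (+ 4 * N) + (+ 2 * N * y + 0ℤ)
      middle = solve-∀
    f-factorisation _ _ _         _      (suc (suc zero))    = leading N
      where
      leading : ∀ N → + 8 * N * N ≡ + 2 * N * (+ 4 * N)
      leading = solve-∀
    f-factorisation _ _ _         _      (suc (suc (suc _))) = refl

    2[T-N]≡[R+A][R-A-1] : ∀ A → + 2 * T ≡ R * (R - 1ℤ) → + 2 * N ≡ A * (A + 1ℤ) →
                          + 2 * (T - N) ≡ (R + A) * (R - A - 1ℤ)
    2[T-N]≡[R+A][R-A-1] A 2T≡R[R-1] 2N≡A[A+1] = begin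
      + 2 * (T - N)                  ≡⟨ distrib T N ⟩
      + 2 * T - + 2 * N              ≡⟨ cong₂ _-_ 2T≡R[R-1] 2N≡A[A+1] ⟩
      R * (R - 1ℤ) - A * (A + 1ℤ)    ≡⟨ factor R A ⟩
      (R + A) * (R - A - 1ℤ)         ∎
      where
      distrib : ∀ T N → + 2 * (T - N) ≡ + 2 * T - + 2 * N
      distrib = solve-∀
      factor : ∀ R A → R * (R - 1ℤ) - A * (A + 1ℤ) ≡ (R + A) * (R - A - 1ℤ)
      factor = solve-∀

    f-¬irreducible : ∀ A x y → N ≢ 0ℤ → + 2 * T ≡ R * (R - 1ℤ) → + 2 * N ≡ A * (A + 1ℤ) →
                     + 2 * x + y ≡ + 2 * R - 1ℤ → + 2 * (x * y) ≡ (R + A) * (R - A - 1ℤ) → ¬ Irreducible f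
    f-¬irreducible A x y N≢0 2T≡R[R-1] 2N≡A[A+1] 2x+y≡2R-1 2xy≡[R+A][R-A-1] =
      nonconstant-product-¬irreducible f (x ∷ + 2 * N ∷ []) (y ∷ + 4 * N ∷ [])
        (f-factorisation x y 2x+y≡2R-1 xy≡T-N)
        (linear-hasDegree (*-≢0 {+ 2} (λ ()) N≢0)) (linear-hasDegree (*-≢0 {+ 4} (λ ()) N≢0))
      where
      xy≡T-N : x * y ≡ T - N
      xy≡T-N = ℤ.*-cancelˡ-≡ (+ 2) _ _ (trans 2xy≡[R+A][R-A-1] (sym (2[T-N]≡[R+A][R-A-1] A 2T≡R[R-1] 2N≡A[A+1])))

  fpoly≡f : ∀ n r → fpoly n r ≡ Fnr.f (+ n) (+ r) (+ tri r)
  fpoly≡f n r = cong₂ (λ b c → + tri r - + n ∷ b ∷ c ∷ [])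
    (cong₂ (λ 2n 2r → 2n * (2r - 1ℤ)) (ℤ.pos-* 2 n) (ℤ.pos-* 2 r))
    (trans (ℤ.pos-* (8 ℕ.* n) n) (cong (_* + n) (ℤ.pos-* 8 n)))

module IntegerForms where

  open import Data.Nat as ℕ using (zero; suc)
  open import Data.Nat.DivMod using (m*n/n≡m)
  import Data.Nat.Properties as ℕ
  open import Data.Integer using (+_; _+_; _-_; _*_; 1ℤ; ∣_∣)
  import Data.Integer.Properties as ℤ
  open import Data.Integer.Divisibility.Signed using (divides; ∣ᵤ⇒∣)
  open import Data.Integer.Tactic.RingSolver using (solve-∀)
  open import Data.Product using (∃-syntax; _,_)
  open import Relation.Binary.PropositionalEquality
  open ≡-Reasoning
  open NaturalNumbers

  +2*[m*[m+1]/2]≡m*[m+1] : ∀ m → + 2 * + (m ℕ.* (m ℕ.+ 1) ℕ./ 2) ≡ + m * (+ m + 1ℤ)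
  +2*[m*[m+1]/2]≡m*[m+1] m = begin
    + 2 * + (m ℕ.* (m ℕ.+ 1) ℕ./ 2)    ≡⟨ ℤ.pos-* 2 (m ℕ.* (m ℕ.+ 1) ℕ./ 2) ⟨
    + (2 ℕ.* (m ℕ.* (m ℕ.+ 1) ℕ./ 2))  ≡⟨ cong +_ (2*[m*[m+1]/2]≡m*[m+1] m) ⟩
    + (m ℕ.* (m ℕ.+ 1))                ≡⟨ ℤ.pos-* m (m ℕ.+ 1) ⟩
    + m * + (m ℕ.+ 1)                  ≡⟨ cong (λ k → + m * k) (ℤ.pos-+ m 1) ⟩
    + m * (+ m + 1ℤ)                   ∎

  n≡a[a+1]/2⇒2n≡a[a+1] : ∀ n a → n ≡ a ℕ.* (a ℕ.+ 1) ℕ./ 2 → + 2 * + n ≡ + a * (+ a + 1ℤ)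
  n≡a[a+1]/2⇒2n≡a[a+1] n a n≡a[a+1]/2 = trans (cong (λ k → + 2 * + k) n≡a[a+1]/2) (+2*[m*[m+1]/2]≡m*[m+1] a)

  +2*tri≡r*[r-1] : ∀ r → + 2 * + tri r ≡ + r * (+ r - 1ℤ)
  +2*tri≡r*[r-1] zero    = refl
  +2*tri≡r*[r-1] (suc m) = begin
    + 2 * + tri (suc m)
      ≡⟨ cong (λ k → + 2 * + (k ℕ./ 2)) (trans (ℕ.*-comm (suc m) m) (cong (m ℕ.*_) (ℕ.+-comm 1 m))) ⟩
    + 2 * + (m ℕ.* (m ℕ.+ 1) ℕ./ 2)  ≡⟨ +2*[m*[m+1]/2]≡m*[m+1] m ⟩
    + m * (+ m + 1ℤ)                 ≡⟨ shift (+ m) ⟩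
    (1ℤ + + m) * (1ℤ + + m - 1ℤ)     ≡⟨ cong (λ R → R * (R - 1ℤ)) (ℤ.pos-+ 1 m) ⟨
    + suc m * (+ suc m - 1ℤ)         ∎
    where
    shift : ∀ M → M * (M + 1ℤ) ≡ (1ℤ + M) * (1ℤ + M - 1ℤ)
    shift = solve-∀

  congMod⇒t-n≡1+2nK : ∀ t n → CongMod t (n ℕ.+ 1) (2 ℕ.* n) → ∃[ K ] + t - + n ≡ 1ℤ + + 2 * + n * K
  congMod⇒t-n≡1+2nK t n 2n∣t-n-1 with ∣ᵤ⇒∣ {+ (2 ℕ.* n)} {+ t - + (n ℕ.+ 1)} 2n∣t-n-1
  ... | divides K t-n-1≡K*2n = K , (begin
    + t - + n                 ≡⟨ shift (+ t) (+ n) ⟩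
    + t - (+ n + 1ℤ) + 1ℤ     ≡⟨ cong (λ z → + t - z + 1ℤ) (ℤ.pos-+ n 1) ⟨
    + t - + (n ℕ.+ 1) + 1ℤ    ≡⟨ cong (_+ 1ℤ) t-n-1≡K*2n ⟩
    K * + (2 ℕ.* n) + 1ℤ      ≡⟨ cong (λ z → K * z + 1ℤ) (ℤ.pos-* 2 n) ⟩
    K * (+ 2 * + n) + 1ℤ      ≡⟨ reorder K (+ n) ⟩
    1ℤ + + 2 * + n * K        ∎)
    where
    shift : ∀ T N → T - N ≡ T - (N + 1ℤ) + 1ℤ
    shift = solve-∀
    reorder : ∀ K N → K * (+ 2 * N) + 1ℤ ≡ 1ℤ + + 2 * N * K
    reorder = solve-∀

  ∣x∣*∣x∣≡m : ∀ x {m} → x * x ≡ + m → ∣ x ∣ ℕ.* ∣ x ∣ ≡ m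
  ∣x∣*∣x∣≡m x x²≡m = trans (sym (ℤ.abs-* x x)) (cong ∣_∣ x²≡m)

  pos-[2n]²[8n+1] : ∀ n → + (2 ℕ.* n ℕ.* (2 ℕ.* n) ℕ.* (8 ℕ.* n ℕ.+ 1)) ≡
                          + 2 * + n * (+ 2 * + n) * (+ 8 * + n + 1ℤ)
  pos-[2n]²[8n+1] n = trans (ℤ.pos-* (2 ℕ.* n ℕ.* (2 ℕ.* n)) (8 ℕ.* n ℕ.+ 1)) (cong₂ _*_
    (trans (ℤ.pos-* (2 ℕ.* n) (2 ℕ.* n)) (cong₂ _*_ (ℤ.pos-* 2 n) (ℤ.pos-* 2 n)))
    (trans (ℤ.pos-+ (8 ℕ.* n) 1) (cong (_+ 1ℤ) (ℤ.pos-* 8 n))))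

  2n≡a[a+1]⇒n≡a[a+1]/2 : ∀ n a → 2 ℕ.* n ≡ a ℕ.* (a ℕ.+ 1) → n ≡ a ℕ.* (a ℕ.+ 1) ℕ./ 2
  2n≡a[a+1]⇒n≡a[a+1]/2 n a 2n≡a[a+1] = begin
    n                       ≡⟨ m*n/n≡m n 2 ⟨
    n ℕ.* 2 ℕ./ 2           ≡⟨ cong (ℕ._/ 2) (trans (ℕ.*-comm n 2) 2n≡a[a+1]) ⟩
    a ℕ.* (a ℕ.+ 1) ℕ./ 2   ∎

  nontriangular⇒nonsquare : ∀ n .{{_ : ℕ.NonZero n}} → (∀ a → n ≢ a ℕ.* (a ℕ.+ 1) ℕ./ 2) →
                            ∀ x → x * x ≢ + 2 * + n * (+ 2 * + n) * (+ 8 * + n + 1ℤ)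
  nontriangular⇒nonsquare n nontriangular x x²≡Δ =
    let s , 8n+1≡s² = square-quotient ∣ x ∣ (2 ℕ.* n) (8 ℕ.* n ℕ.+ 1) (ℕ.≢-nonZero⁻¹ (2 ℕ.* n) {{ℕ.m*n≢0 2 n}})
                                      (∣x∣*∣x∣≡m x (trans x²≡Δ (sym (pos-[2n]²[8n+1] n))))
        a , 2n≡a[a+1] = 8n+1≡s²⇒2n≡a[a+1] n s 8n+1≡s²
    in nontriangular a (2n≡a[a+1]⇒n≡a[a+1]/2 n a 2n≡a[a+1])

open import Data.Nat using (ℕ; _≤_; _<_; _*_; _+_; _/_; s≤s; z≤n)
open import Data.Nat.Primality using (Prime)
open import Data.Integer using (ℤ; +_; +<+) renaming (_<_ to _<ℤ_)
import Data.Integer as ℤ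
open import Data.Integer.Divisibility using (_∣_)
open import Data.Product using (_×_; ∃-syntax; _,_; proj₁; proj₂)
open import Function.Bundles using (_⇔_; mk⇔)
open import Relation.Nullary using (¬_)
open import Relation.Binary.PropositionalEquality using (_≡_; _≢_; trans; sym; subst)
open Polynomials
open Family
open IntegerForms

mainTheorem1 : (n r : ℕ) → 2 ≤ n → 1 ≤ r → r < 4 * n → CongMod (tri r) (n + 1) (2 * n)
    → ((+ 0) <ℤ lead (fpoly n r))
    × (∀ (p : ℕ) → Prime p → ∃[ t ] ¬ ((+ p) ∣ eval (fpoly n r) t))
    × (Irreducible (fpoly n r) ⇔ (∀ (a : ℕ) → n ≢ (a * (a + 1)) / 2))
mainTheorem1 n r (s≤s (s≤s _)) _ _ 2n∣T-n-1 =
  +<+ (s≤s z≤n) , subst Parts[b,c] (sym (fpoly≡f n r)) (part-c , mk⇔ part-b⇒ part-b⇐)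
  where
  open Fnr (+ n) (+ r) (+ tri r)
  Parts[b,c] : Poly → Set
  Parts[b,c] g = (∀ (p : ℕ) → Prime p → ∃[ t ] ¬ ((+ p) ∣ eval g t))
               × (Irreducible g ⇔ (∀ (a : ℕ) → n ≢ (a * (a + 1)) / 2))
  2T≡R[R-1] : + 2 ℤ.* + tri r ≡ + r ℤ.* (+ r ℤ.- ℤ.1ℤ)
  2T≡R[R-1] = +2*tri≡r*[r-1] r
  K : ℤ
  K = proj₁ (congMod⇒t-n≡1+2nK (tri r) n 2n∣T-n-1)
  T-N≡1+2NK : + tri r ℤ.- + n ≡ ℤ.1ℤ ℤ.+ + 2 ℤ.* + n ℤ.* K
  T-N≡1+2NK = proj₂ (congMod⇒t-n≡1+2nK (tri r) n 2n∣T-n-1)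
  part-c : ∀ p → Prime p → ∃[ t ] ¬ ((+ p) ∣ eval f t)
  part-c = no-fixed-prime-divisor f (f-∣values⇒∣1 K T-N≡1+2NK)
  part-b⇒ : Irreducible f → ∀ a → n ≢ (a * (a + 1)) / 2
  part-b⇒ f-irreducible a n≡a[a+1]/2 =
    let x , y , 2x+y≡2R-1 , 2xy≡[R+A][R-A-1] = halve-even-factor r a
    in f-¬irreducible (+ a) x y (λ ()) 2T≡R[R-1] (n≡a[a+1]/2⇒2n≡a[a+1] n a n≡a[a+1]/2)
         2x+y≡2R-1 2xy≡[R+A][R-A-1] f-irreducible
  part-b⇐ : (∀ a → n ≢ (a * (a + 1)) / 2) → Irreducible f
  part-b⇐ nontriangular = primitive-quadratic-irreducible f (f-hasDegree2 (λ ())) (f-primitive K T-N≡1+2NK)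
    λ x x²≡Δ → nontriangular⇒nonsquare n nontriangular x (trans x²≡Δ (f-discriminant 2T≡R[R-1]))
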